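{- The assignment $\langle A,C\rangle\mapsto g\langle A,C\rangle:=\langle A,A\cap C,C\rangle$ defines a bounded lattice embedding $g\colon\mathcal{F}(\kappa)\times\mathcal{F}(\kappa)\to M_3[\mathcal{F}(\kappa)]$. In particular, the range of $g$ is a bounded Boolean sublattice of $M_3[\mathcal{F}(\kappa)]$ isomorphic to $\mathcal{F}(\kappa)\times\mathcal{F}(\kappa)$.
   Context: Let $\kappa$ be an infinite cardinal, identified with the set of ordinals less than $\kappa$. Let $\mathcal{F}(\kappa)=\{X\subseteq\kappa : X \text{ is finite or } \kappa\setminus X \text{ is finite}\}$, a Boolean lattice under union and intersection. For subsets $A,B,C\subseteq\kappa$ put $\mu\langle A,B,C\rangle=(A\cap B)\cup(A\cap C)\cup(B\cap C)$ and $\overline{\langle A,B,C\rangle}=\langle A\cup\mu,\ B\cup\mu,\ C\cup\mu\rangle$ with $\mu=\mu\langle A,B,C\rangle$. A triple is balanced if $A\cap B=A\cap C=B\cap C$. $M_3[\mathcal{F}(\kappa)]$ is the lattice of balanced triples in $\mathcal{F}(\kappa)^3$, ordered componentwise, with bounds $\langle\emptyset,\emptyset,\emptyset\rangle$, $\langle\kappa,\kappa,\kappa\rangle$, meet the componentwise intersection and join $\langle A,B,C\rangle\vee\langle A',B',C'\rangle=\overline{\langle A\cup A',B\cup B',C\cup C'\rangle}$. -}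

module Defs where

open import Data.Bool using (Bool; true; false; _∧_; _∨_; not)
open import Data.List using (List)
open import Data.List.Membership.Propositional using (_∈_)
open import Data.Product using (_×_; _,_; ∃)
open import Data.Sum using (_⊎_)
open import Relation.Binary.PropositionalEquality using (_≡_)
open import Relation.Nullary using (¬_)

-- Subsets of an underlying set K (playing the role of κ), as characteristic functions.
Subset : Set → Set
Subset K = K → Bool

module _ {K : Set} where

  ∅ˢ : Subset K
  ∅ˢ _ = false

  fullˢ : Subset K
  fullˢ _ = true

  _∪_ : Subset K → Subset K → Subset K
  (X ∪ Y) x = X x ∨ Y x

  _∩_ : Subset K → Subset K → Subset K
  (X ∩ Y) x = X x ∧ Y x

  complement : Subset K → Subset K
  complement X x = not (X x)

  _≐_ : Subset K → Subset K → Set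
  X ≐ Y = ∀ x → X x ≡ Y x

  IsFinite : Subset K → Set
  IsFinite X = ∃ λ (xs : List K) → ∀ x → X x ≡ true → x ∈ xs

  InF : Subset K → Set
  InF X = IsFinite X ⊎ IsFinite (complement X)

Infinite : Set → Set
Infinite K = ¬ (∃ λ (xs : List K) → ∀ (x : K) → x ∈ xs)

Triple : Set → Set
Triple K = Subset K × Subset K × Subset K

module _ {K : Set} where

  _≐₃_ : Triple K → Triple K → Set
  (A , B , C) ≐₃ (A' , B' , C') = (A ≐ A') × (B ≐ B') × (C ≐ C')

  μ : Triple K → Subset K
  μ (A , B , C) = (A ∩ B) ∪ ((A ∩ C) ∪ (B ∩ C))

  closure : Triple K → Triple K
  closure t@(A , B , C) = (A ∪ μ t) , (B ∪ μ t) , (C ∪ μ t)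

  Balanced : Triple K → Set
  Balanced (A , B , C) = ((A ∩ B) ≐ (A ∩ C)) × ((A ∩ C) ≐ (B ∩ C))

  InM3 : Triple K → Set
  InM3 t@(A , B , C) = (InF A × InF B × InF C) × Balanced t

  _∧₃_ : Triple K → Triple K → Triple K
  (A , B , C) ∧₃ (A' , B' , C') = (A ∩ A') , (B ∩ B') , (C ∩ C')

  _∨₃_ : Triple K → Triple K → Triple K
  (A , B , C) ∨₃ (A' , B' , C') = closure ((A ∪ A') , (B ∪ B') , (C ∪ C'))

  ⊥₃ : Triple K
  ⊥₃ = ∅ˢ , ∅ˢ , ∅ˢ

  ⊤₃ : Triple K
  ⊤₃ = fullˢ , fullˢ , fullˢ

  g : Subset K → Subset K → Triple K
  g A C = A , (A ∩ C) , C

-- Every pairwise intersection of A, A ∩ C, C is A ∩ C, so g lands in the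
-- balanced triples, and 𝓕(κ) is closed under ∩.  Meets in M₃ are
-- componentwise, so g preserves them by commutativity of ∩.  The join of
-- g⟨A,C⟩ and g⟨A',C'⟩ is the closure of ⟨A ∪ A', (A ∩ C) ∪ (A' ∩ C'), C ∪ C'⟩,
-- whose middle component lies below the meet of the outer two; for such a
-- triple μ is that meet, so the closure is g⟨A ∪ A', C ∪ C'⟩.  Finally g
-- keeps A and C as its outer components, hence is injective.
module Submission where

open import Algebra.Bundles using (CommutativeMonoid)
open import Data.Bool using (true; false; _∧_; _∨_; not; _≤_; b≤b; f≤t)
open import Data.Bool.Properties
  using (≤-refl; ≤-minimum; ≤-maximum; ∧-assoc; ∧-idem; ∨-idem; ∨-comm; ∧-commutativeMonoid)
open import Data.List using (_++_)
open import Data.List.Membership.Propositional.Properties using (∈-++⁺ˡ; ∈-++⁺ʳ)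
open import Data.Product using (_×_; _,_)
open import Data.Sum using (_⊎_; inj₁; inj₂; [_,_])
open import Relation.Binary.PropositionalEquality using (_≡_; refl; sym; trans; cong)
open Relation.Binary.PropositionalEquality.≡-Reasoning

open import Defs

open import Algebra.Properties.CommutativeSemigroup
  (CommutativeMonoid.commutativeSemigroup ∧-commutativeMonoid) using (interchange)

x∧y≤x : ∀ x y → x ∧ y ≤ x
x∧y≤x true  y = ≤-maximum y
x∧y≤x false y = b≤b

x∧y≤y : ∀ x y → x ∧ y ≤ y
x∧y≤y true  y = ≤-refl
x∧y≤y false y = ≤-minimum y

x≤x∨y : ∀ x y → x ≤ x ∨ y
x≤x∨y true  y = b≤b
x≤x∨y false y = ≤-minimum y

y≤x∨y : ∀ x y → y ≤ x ∨ y
y≤x∨y true  y = ≤-maximum y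
y≤x∨y false y = ≤-refl

∨-lub : ∀ {x y z} → x ≤ z → y ≤ z → x ∨ y ≤ z
∨-lub {true}  x≤z _   = x≤z
∨-lub {false} _   y≤z = y≤z

∧-mono-≤ : ∀ {x x' y y'} → x ≤ x' → y ≤ y' → x ∧ y ≤ x' ∧ y'
∧-mono-≤ {false} b≤b _   = b≤b
∧-mono-≤ {true}  b≤b y≤y' = y≤y'
∧-mono-≤ {y' = y'} f≤t _ = ≤-minimum y'

x≤y⇒x∨y≡y : ∀ {x y} → x ≤ y → x ∨ y ≡ y
x≤y⇒x∨y≡y {y = y} b≤b = ∨-idem y
x≤y⇒x∨y≡y f≤t = refl

≤-true : ∀ {x y} → x ≤ y → x ≡ true → y ≡ true
≤-true b≤b x≡true = x≡true

∨-true : ∀ x y → x ∨ y ≡ true → x ≡ true ⊎ y ≡ true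
∨-true true  y _ = inj₁ refl
∨-true false y y≡true = inj₂ y≡true

not-∧-≤ : ∀ x y → not (x ∧ y) ≤ not x ∨ not y
not-∧-≤ true  y = ≤-refl
not-∧-≤ false y = b≤b

∧-≤-∨-medial : ∀ x y x' y' → (x ∧ y) ∨ (x' ∧ y') ≤ (x ∨ x') ∧ (y ∨ y')
∧-≤-∨-medial x y x' y' =
  ∨-lub (∧-mono-≤ (x≤x∨y x x') (x≤x∨y y y')) (∧-mono-≤ (y≤x∨y x x') (y≤x∨y y y'))

median-below : ∀ x y z → y ≤ x ∧ z → (x ∧ y) ∨ ((x ∧ z) ∨ (y ∧ z)) ≡ x ∧ z
median-below true  true  true  _ = refl
median-below true  false true  _ = refl
median-below true  false false _ = refl
median-below false false z     _ = refl

module _ {K : Set} where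

  _⊆_ : Subset K → Subset K → Set
  X ⊆ Y = ∀ x → X x ≤ Y x

  IsFinite-⊆ : {X Y : Subset K} → X ⊆ Y → IsFinite Y → IsFinite X
  IsFinite-⊆ X⊆Y (xs , Y⊆xs) = xs , λ x Xx → Y⊆xs x (≤-true (X⊆Y x) Xx)

  IsFinite-∪ : {X Y : Subset K} → IsFinite X → IsFinite Y → IsFinite (X ∪ Y)
  IsFinite-∪ {X} {Y} (xs , X⊆xs) (ys , Y⊆ys) =
    xs ++ ys , λ x X∪Yx → [ (λ Xx → ∈-++⁺ˡ (X⊆xs x Xx)) , (λ Yx → ∈-++⁺ʳ xs (Y⊆ys x Yx)) ]
                            (∨-true (X x) (Y x) X∪Yx)

  InF-∩ : (X Y : Subset K) → InF X → InF Y → InF (X ∩ Y)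
  InF-∩ X Y (inj₁ finX) _           = inj₁ (IsFinite-⊆ (λ x → x∧y≤x (X x) (Y x)) finX)
  InF-∩ X Y (inj₂ _)    (inj₁ finY) = inj₁ (IsFinite-⊆ (λ x → x∧y≤y (X x) (Y x)) finY)
  InF-∩ X Y (inj₂ cofX) (inj₂ cofY) =
    inj₂ (IsFinite-⊆ (λ x → not-∧-≤ (X x) (Y x)) (IsFinite-∪ cofX cofY))

  g-balanced : (A C : Subset K) → Balanced (g A C)
  g-balanced A C =
      (λ x → trans (sym (∧-assoc (A x) (A x) (C x))) (cong (_∧ C x) (∧-idem (A x))))
    , (λ x → trans (cong (A x ∧_) (sym (∧-idem (C x)))) (sym (∧-assoc (A x) (C x) (C x))))

  g-InM3 : (A C : Subset K) → InF A → InF C → InM3 (g A C)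
  g-InM3 A C finA finC = (finA , InF-∩ A C finA finC , finC) , g-balanced A C

  closure-below : (X Y Z : Subset K) → Y ⊆ (X ∩ Z) → g X Z ≐₃ closure (X , Y , Z)
  closure-below X Y Z Y⊆X∩Z =
      absorbs X (λ x → x∧y≤x (X x) (Z x))
    , (λ x → sym (trans (cong (Y x ∨_) (μ≡X∩Z x)) (x≤y⇒x∨y≡y (Y⊆X∩Z x))))
    , absorbs Z (λ x → x∧y≤y (X x) (Z x))
    where
    μ≡X∩Z : ∀ x → μ (X , Y , Z) x ≡ (X ∩ Z) x
    μ≡X∩Z x = median-below (X x) (Y x) (Z x) (Y⊆X∩Z x)

    absorbs : (W : Subset K) → (X ∩ Z) ⊆ W → W ≐ (W ∪ μ (X , Y , Z))
    absorbs W X∩Z⊆W x = sym (begin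
      W x ∨ μ (X , Y , Z) x  ≡⟨ cong (W x ∨_) (μ≡X∩Z x) ⟩
      W x ∨ (X ∩ Z) x        ≡⟨ ∨-comm (W x) ((X ∩ Z) x) ⟩
      (X ∩ Z) x ∨ W x        ≡⟨ x≤y⇒x∨y≡y (X∩Z⊆W x) ⟩
      W x                    ∎)

  g-preserves-∨ : (A C A' C' : Subset K) → g (A ∪ A') (C ∪ C') ≐₃ (g A C ∨₃ g A' C')
  g-preserves-∨ A C A' C' =
    closure-below (A ∪ A') ((A ∩ C) ∪ (A' ∩ C')) (C ∪ C')
      (λ x → ∧-≤-∨-medial (A x) (C x) (A' x) (C' x))

  g-preserves-∧ : (A C A' C' : Subset K) → g (A ∩ A') (C ∩ C') ≐₃ (g A C ∧₃ g A' C')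
  g-preserves-∧ A C A' C' =
    (λ _ → refl) , (λ x → interchange (A x) (A' x) (C x) (C' x)) , (λ _ → refl)

  g-injective : (A C A' C' : Subset K) → g A C ≐₃ g A' C' → (A ≐ A') × (C ≐ C')
  g-injective A C A' C' (A≐A' , _ , C≐C') = A≐A' , C≐C'

lemma5p1 : {K : Set} → Infinite K →
    (∀ (A C : Subset K) → InF A → InF C → InM3 (g A C))
    × (∀ (A C A' C' : Subset K) → InF A → InF C → InF A' → InF C' →
         g (A ∪ A') (C ∪ C') ≐₃ (g A C ∨₃ g A' C'))
    × (∀ (A C A' C' : Subset K) → InF A → InF C → InF A' → InF C' →
         g (A ∩ A') (C ∩ C') ≐₃ (g A C ∧₃ g A' C'))
    × (g (∅ˢ {K}) ∅ˢ ≐₃ ⊥₃)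
    × (g (fullˢ {K}) fullˢ ≐₃ ⊤₃)
    × (∀ (A C A' C' : Subset K) → InF A → InF C → InF A' → InF C' →
         g A C ≐₃ g A' C' → (A ≐ A') × (C ≐ C'))
lemma5p1 _ =
    g-InM3
  , (λ A C A' C' _ _ _ _ → g-preserves-∨ A C A' C')
  , (λ A C A' C' _ _ _ _ → g-preserves-∧ A C A' C')
  , ((λ _ → refl) , (λ _ → refl) , (λ _ → refl))
  , ((λ _ → refl) , (λ _ → refl) , (λ _ → refl))
  , (λ A C A' C' _ _ _ _ → g-injective A C A' C')
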